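{- Let $N$ and $d$ be positive integers with $d \mid N$, and let $A \subseteq \mathbb{Z}_N$ be $d$-cube-free. Then $$|A| \leqslant \frac{d-1}{d}N$$ whenever at least one of the following holds: (i) $d = 3$; (ii) $d$ is the smallest prime factor of $N$; (iii) $N$ is a power of some prime $p$.
   Context: For a multiset $S = \{a_1,\ldots,a_d\}$ of $d$ elements of $\mathbb{Z}_N$, the projective $d$-cube generated by $S$ is $\Sigma^*S = \{\sum_{i\in I} a_i : \varnothing \neq I \subseteq [d]\}$, the set of all sums over nonempty subsets of indices. A set $A \subseteq \mathbb{Z}_N$ is $d$-cube-free if there is no multiset $S$ of size $d$ (of elements of $\mathbb{Z}_N$) with $\Sigma^*S \subseteq A$. For example, $A$ is $3$-cube-free if it contains no set of the form $\{x,y,z,x+y,y+z,x+z,x+y+z\}$. -}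

module Defs where

open import Data.Nat using (ℕ; zero; suc; _+_; NonZero)
open import Data.Nat.DivMod using (_mod_)
open import Data.Fin using (Fin; toℕ; zero; suc)
open import Data.Fin.Subset using (Subset; Nonempty; _∈_)
open import Data.Vec using (_∷_; [])
open import Data.Bool using (true; false)
open import Data.Product using (∃; Σ)
open import Relation.Nullary using (¬_)

-- Z_N is modelled as Fin N, with addition mod N.
-- A multiset of d elements of Z_N is a family  a : Fin d → Fin N.

subsetSumℕ : ∀ {d N} → (Fin d → Fin N) → Subset d → ℕ
subsetSumℕ {zero}  a []          = 0
subsetSumℕ {suc d} a (true ∷ I)  = toℕ (a zero) + subsetSumℕ (λ i → a (suc i)) I
subsetSumℕ {suc d} a (false ∷ I) = subsetSumℕ (λ i → a (suc i)) I

subsetSum : ∀ {d N} .{{_ : NonZero N}} → (Fin d → Fin N) → Subset d → Fin N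
subsetSum {N = N} a I = subsetSumℕ a I mod N

CubeIn : ∀ {d N} .{{_ : NonZero N}} → (Fin d → Fin N) → Subset N → Set
CubeIn {d} a A = (I : Subset d) → Nonempty I → subsetSum a I ∈ A

CubeFree : ∀ (d : ℕ) {N} .{{_ : NonZero N}} → Subset N → Set
CubeFree d {N} A = ¬ (Σ (Fin d → Fin N) λ a → CubeIn a A)

{-# OPTIONS --safe #-}
-- Let B be the complement of A; it contains 0, since otherwise the cube generated by d zeros lies in A.
-- Assume d |B| < N. The projective cube generated by (y, x, …, x), with d − 1 copies of x, consists of
-- x, 2x, …, (d−1)x and y, y + x, …, y + (d−1)x. If the first d − 1 multiples of x avoid B, then the d
-- translates B − kx cover at most d |B| < N points, so some y avoids all of them and A contains a cube.
-- Such a step x exists by a union bound over the multipliers j = 1, …, d − 1: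
--  (i)  for d = 3, x ↦ 2x is at most two-to-one and |B| + 2 |B| < N;
--  (ii) if every prime factor of N is at least d, then x ↦ jx is a bijection and (d − 1) |B| < N;
--  (iii) for N = p^k and d = p^m one counts only units x. A unit multiplier permutes the units, and a
--       multiplier p i sends x to p (i x mod p^(k−1)), which is the same problem modulo p^(k−1) for the
--       set {y | p y ∈ B}. Induction on m bounds the bad units by p^(m−1) (p − 1) (|B| − 1), which is
--       less than p^(k−1) (p − 1), the number of units.

module Submission where

open import Data.Bool using (Bool; true; false; T; _∧_; _∨_; not; if_then_else_)
open import Data.Bool.Properties using (∧-zeroʳ; ∧-identityʳ; ∧-distribˡ-∨; ∨-zeroʳ; ¬-not; not-injective)
open import Data.Empty using (⊥-elim)
open import Data.Fin using (Fin; toℕ; fromℕ<) renaming (zero to fzero; suc to fsuc)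
open import Data.Fin.Properties using (toℕ-fromℕ<)
open import Data.Fin.Subset using (Subset; ∣_∣; Nonempty; _∈_)
open import Data.Fin.Subset.Properties using (p⊆q⇒∣p∣≤∣q∣; ∣p∣≤n; ∣⁅x⁆∣≡1; x∈⁅y⁆⇒x≡y)
open import Data.List using (List; []; _∷_)
open import Data.List.Relation.Unary.All using (All; []; _∷_)
open import Data.Nat
open import Data.Nat.Coprimality using (Coprime; coprime-divisor)
open import Data.Nat.Divisibility
open import Data.Nat.DivMod
open import Data.Nat.ListAction using (product)
open import Data.Nat.Primality using (Prime; prime⇒nonTrivial; euclidsLemma; prime⇒irreducible)
open import Data.Nat.Primality.Factorisation using (factorise; PrimeFactorisation)
open import Data.Nat.Properties
open import Data.Product using (Σ; _×_; _,_)
open import Data.Sum using (_⊎_; inj₁; inj₂; [_,_]′)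
open import Data.Unit using (tt)
open import Data.Vec using ([]; _∷_; here; there)
open import Defs
open import Relation.Binary.PropositionalEquality
open import Relation.Nullary using (¬_; yes; no; does; contradiction)
open import Relation.Nullary.Decidable using (dec-true; dec-false)
open import Algebra.Properties.CommutativeSemigroup +-commutativeSemigroup using (interchange; x∙yz≈y∙xz)

-- Counting Boolean predicates on initial segments of ℕ

∧-cong-true : ∀ a {b c} → (a ≡ true → b ≡ c) → a ∧ b ≡ a ∧ c
∧-cong-true true  b≡c = b≡c refl
∧-cong-true false b≡c = refl

indicator : Bool → ℕ
indicator true  = 1
indicator false = 0

count : (ℕ → Bool) → ℕ → ℕ
count P zero    = 0
count P (suc n) = indicator (P 0) + count (λ x → P (suc x)) n

anyBelow : ℕ → (ℕ → Bool) → Bool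
anyBelow zero    Q = false
anyBelow (suc m) Q = Q 0 ∨ anyBelow m (λ j → Q (suc j))

sumBelow : ℕ → (ℕ → ℕ) → ℕ
sumBelow zero    f = 0
sumBelow (suc m) f = f 0 + sumBelow m (λ j → f (suc j))

anyBelow-false : ∀ m Q → anyBelow m Q ≡ false → ∀ j → j < m → Q j ≡ false
anyBelow-false (suc m) Q none j j<m with Q 0 in Q0
anyBelow-false (suc m) Q none zero    _         | false = Q0
anyBelow-false (suc m) Q none (suc j) (s<s j<m) | false = anyBelow-false m _ none j j<m

anyBelow-true : ∀ m Q j → j < m → Q j ≡ true → anyBelow m Q ≡ true
anyBelow-true (suc m) Q zero    _         Qj rewrite Qj = refl
anyBelow-true (suc m) Q (suc j) (s<s j<m) Qj
  rewrite anyBelow-true m (λ i → Q (suc i)) j j<m Qj = ∨-zeroʳ (Q 0)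

anyBelow-witness : ∀ m Q → anyBelow m Q ≡ true → Σ ℕ λ j → j < m × Q j ≡ true
anyBelow-witness (suc m) Q some with Q 0 in Q0
... | true  = 0 , z<s , Q0
... | false with anyBelow-witness m _ some
...   | j , j<m , Qj = suc j , s<s j<m , Qj

anyBelow-cong : ∀ m {Q Q′ : ℕ → Bool} → (∀ j → Q j ≡ Q′ j) → anyBelow m Q ≡ anyBelow m Q′
anyBelow-cong zero    eq = refl
anyBelow-cong (suc m) eq = cong₂ _∨_ (eq 0) (anyBelow-cong m (λ j → eq (suc j)))

count-cong : ∀ n {P Q : ℕ → Bool} → (∀ x → x < n → P x ≡ Q x) → count P n ≡ count Q n
count-cong zero    eq = refl
count-cong (suc n) eq =
  cong₂ _+_ (cong indicator (eq 0 z<s)) (count-cong n (λ x x<n → eq (suc x) (s<s x<n)))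

indicator-mono : ∀ a b → (a ≡ true → b ≡ true) → indicator a ≤ indicator b
indicator-mono false b a⇒b = z≤n
indicator-mono true  b a⇒b rewrite a⇒b refl = ≤-refl

count-mono : ∀ n {P Q : ℕ → Bool} → (∀ x → x < n → P x ≡ true → Q x ≡ true) →
             count P n ≤ count Q n
count-mono zero    P⇒Q = z≤n
count-mono (suc n) {P} {Q} P⇒Q =
  +-mono-≤ (indicator-mono (P 0) (Q 0) (P⇒Q 0 z<s)) (count-mono n (λ x x<n → P⇒Q (suc x) (s<s x<n)))

count-const-true : ∀ n → count (λ _ → true) n ≡ n
count-const-true zero    = refl
count-const-true (suc n) = cong suc (count-const-true n)

count-const-false : ∀ n → count (λ _ → false) n ≡ 0
count-const-false zero    = refl
count-const-false (suc n) = count-const-false n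

indicator-∨ : ∀ a b → indicator (a ∨ b) ≤ indicator a + indicator b
indicator-∨ true  b = s≤s z≤n
indicator-∨ false b = ≤-refl

count-∨ : ∀ n (P Q : ℕ → Bool) → count (λ x → P x ∨ Q x) n ≤ count P n + count Q n
count-∨ zero    P Q = z≤n
count-∨ (suc n) P Q = begin
  indicator (P 0 ∨ Q 0) + count (λ x → P (suc x) ∨ Q (suc x)) n
    ≤⟨ +-mono-≤ (indicator-∨ (P 0) (Q 0)) (count-∨ n _ _) ⟩
  (indicator (P 0) + indicator (Q 0)) + (count (λ x → P (suc x)) n + count (λ x → Q (suc x)) n)
    ≡⟨ interchange (indicator (P 0)) _ _ _ ⟩
  count P (suc n) + count Q (suc n) ∎
  where open ≤-Reasoning

count-anyBelow : ∀ n m (D : ℕ → Bool) (Q : ℕ → ℕ → Bool) →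
  count (λ x → D x ∧ anyBelow m (λ j → Q j x)) n ≤ sumBelow m (λ j → count (λ x → D x ∧ Q j x) n)
count-anyBelow n zero D Q =
  ≤-reflexive (trans (count-cong n (λ x _ → ∧-zeroʳ (D x))) (count-const-false n))
count-anyBelow n (suc m) D Q = begin
  count (λ x → D x ∧ (Q 0 x ∨ anyBelow m (λ j → Q (suc j) x))) n
    ≡⟨ count-cong n (λ x _ → ∧-distribˡ-∨ (D x) _ _) ⟩
  count (λ x → (D x ∧ Q 0 x) ∨ (D x ∧ anyBelow m (λ j → Q (suc j) x))) n
    ≤⟨ count-∨ n _ _ ⟩
  count (λ x → D x ∧ Q 0 x) n + count (λ x → D x ∧ anyBelow m (λ j → Q (suc j) x)) n
    ≤⟨ +-monoʳ-≤ _ (count-anyBelow n m D (λ j → Q (suc j))) ⟩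
  sumBelow (suc m) (λ j → count (λ x → D x ∧ Q j x) n) ∎
  where open ≤-Reasoning

sumBelow-mono : ∀ m {f g : ℕ → ℕ} → (∀ j → j < m → f j ≤ g j) → sumBelow m f ≤ sumBelow m g
sumBelow-mono zero    f≤g = z≤n
sumBelow-mono (suc m) f≤g = +-mono-≤ (f≤g 0 z<s) (sumBelow-mono m (λ j j<m → f≤g (suc j) (s<s j<m)))

sumBelow-const : ∀ m c → sumBelow m (λ _ → c) ≡ m * c
sumBelow-const zero    c = refl
sumBelow-const (suc m) c = cong (c +_) (sumBelow-const m c)

sumBelow-if : ∀ m (P : ℕ → Bool) c → sumBelow m (λ j → if P j then c else 0) ≡ count P m * c
sumBelow-if zero    P c = refl
sumBelow-if (suc m) P c with P 0
... | true  = cong (c +_) (sumBelow-if m _ c)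
... | false = sumBelow-if m _ c

Separating : ℕ → (ℕ → Bool) → (ℕ → Bool) → Set
Separating n P Q = Σ ℕ λ x → x < n × Q x ≡ true × P x ≡ false

separating-suc : ∀ {n P Q} → Separating n (λ x → P (suc x)) (λ x → Q (suc x)) → Separating (suc n) P Q
separating-suc (x , x<n , Qx , Px) = suc x , s<s x<n , Qx , Px

count-<⇒separating : ∀ n (P Q : ℕ → Bool) → count P n < count Q n → Separating n P Q
count-<⇒separating (suc n) P Q lt with P 0 in eP | Q 0 in eQ
... | false | true  = 0 , z<s , eQ , eP
... | true  | true  = separating-suc (count-<⇒separating n _ _ (+-cancelˡ-< 1 _ _ lt))
... | false | false = separating-suc (count-<⇒separating n _ _ lt)
... | true  | false = separating-suc (count-<⇒separating n _ _ (<-trans (n<1+n _) lt))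

count-+ : ∀ q r P → count P (q + r) ≡ count P q + count (λ x → P (q + x)) r
count-+ zero    r P = refl
count-+ (suc q) r P =
  trans (cong (indicator (P 0) +_) (count-+ q r (λ x → P (suc x)))) (sym (+-assoc (indicator (P 0)) _ _))

count-periodic : ∀ a q P → (∀ x → P (x + q) ≡ P x) → count P (a * q) ≡ a * count P q
count-periodic zero    q P per = refl
count-periodic (suc a) q P per = begin
  count P (q + a * q)                            ≡⟨ count-+ q (a * q) P ⟩
  count P q + count (λ x → P (q + x)) (a * q)    ≡⟨ cong (count P q +_) (count-cong (a * q) λ x _ →
                                                      trans (cong P (+-comm q x)) (per x)) ⟩
  count P q + count P (a * q)                    ≡⟨ cong (count P q +_) (count-periodic a q P per) ⟩
  count P q + a * count P q                      ∎
  where open ≡-Reasoning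

count-not+count : ∀ n P → count (λ x → not (P x)) n + count P n ≡ n
count-not+count zero    P = refl
count-not+count (suc n) P with P 0
... | true  = trans (+-suc _ _) (cong suc (count-not+count n _))
... | false = cong suc (count-not+count n _)

count-split : ∀ n (D P : ℕ → Bool) →
              count P n ≡ count (λ x → D x ∧ P x) n + count (λ x → not (D x) ∧ P x) n
count-split zero    D P = refl
count-split (suc n) D P with D 0 | P 0
... | true  | true  = cong suc (count-split n _ _)
... | true  | false = count-split n _ _
... | false | true  = trans (cong suc (count-split n _ _)) (sym (+-suc _ _))
... | false | false = count-split n _ _

count-remove : ∀ N c P → c < N → count P N ≡ indicator (P c) + count (λ x → P x ∧ not (x ≡ᵇ c)) N
count-remove (suc N) zero P _ = cong (indicator (P 0) +_)
  (cong₂ _+_ (cong indicator (sym (∧-zeroʳ (P 0)))) (count-cong N λ x _ → sym (∧-identityʳ _)))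
count-remove (suc N) (suc c) P (s<s c<N) = begin
  indicator (P 0) + count (λ x → P (suc x)) N
    ≡⟨ cong (indicator (P 0) +_) (count-remove N c (λ x → P (suc x)) c<N) ⟩
  indicator (P 0) + (indicator (P (suc c)) + rest)
    ≡⟨ x∙yz≈y∙xz (indicator (P 0)) (indicator (P (suc c))) rest ⟩
  indicator (P (suc c)) + (indicator (P 0) + rest)
    ≡⟨ cong (λ b → indicator (P (suc c)) + (indicator b + rest)) (sym (∧-identityʳ (P 0))) ⟩
  indicator (P (suc c)) + (indicator (P 0 ∧ true) + rest) ∎
  where
  open ≡-Reasoning
  rest : ℕ
  rest = count (λ x → P (suc x) ∧ not (x ≡ᵇ c)) N

count-positive : ∀ n (P : ℕ → Bool) c → c < n → P c ≡ true → 1 ≤ count P n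
count-positive n P c c<n Pc = begin
  1                                                       ≡⟨ cong indicator Pc ⟨
  indicator (P c)                                         ≤⟨ m≤m+n _ _ ⟩
  indicator (P c) + count (λ x → P x ∧ not (x ≡ᵇ c)) n    ≡⟨ count-remove n c P c<n ⟨
  count P n                                               ∎
  where open ≤-Reasoning

≢⇒≡ᵇ≡false : ∀ a b → ¬ a ≡ b → (a ≡ᵇ b) ≡ false
≢⇒≡ᵇ≡false a b a≢b = ¬-not λ e → a≢b (≡ᵇ⇒≡ a b (subst T (sym e) tt))

InjectiveOn : ℕ → (ℕ → Bool) → (ℕ → ℕ) → Set
InjectiveOn m D f = ∀ x y → x < m → y < m → D x ≡ true → D y ≡ true → f x ≡ f y → x ≡ y

count-injective : ∀ m N (f : ℕ → ℕ) (D P : ℕ → Bool) → (∀ x → x < m → D x ≡ true → f x < N) →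
  InjectiveOn m D f → count (λ x → D x ∧ P (f x)) m ≤ count P N
count-injective zero    N f D P f<N f-inj = z≤n
count-injective (suc m) N f D P f<N f-inj = by-D0 (D 0) refl
  where
  open ≤-Reasoning
  tail : ∀ P′ → count (λ x → D (suc x) ∧ P′ (f (suc x))) m ≤ count P′ N
  tail P′ = count-injective m N (λ x → f (suc x)) (λ x → D (suc x)) P′ (λ x x<m → f<N (suc x) (s<s x<m))
    (λ x y x<m y<m Dx Dy fx≡fy → suc-injective (f-inj (suc x) (suc y) (s<s x<m) (s<s y<m) Dx Dy fx≡fy))
  P′ : ℕ → Bool
  P′ z = P z ∧ not (z ≡ᵇ f 0)
  avoids-f0 : D 0 ≡ true → ∀ x → x < m → (D (suc x) ∧ P (f (suc x))) ≡ (D (suc x) ∧ P′ (f (suc x)))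
  avoids-f0 D0 x x<m = ∧-cong-true (D (suc x)) λ Dx → sym (trans
    (cong (λ b → P (f (suc x)) ∧ not b)
      (≢⇒≡ᵇ≡false (f (suc x)) (f 0) λ e → 0≢1+n (sym (f-inj (suc x) 0 (s<s x<m) z<s Dx D0 e))))
    (∧-identityʳ _))
  by-D0 : ∀ b → D 0 ≡ b → indicator (b ∧ P (f 0)) + count (λ x → D (suc x) ∧ P (f (suc x))) m ≤ count P N
  by-D0 false _  = tail P
  by-D0 true  D0 = begin
    indicator (P (f 0)) + count (λ x → D (suc x) ∧ P (f (suc x))) m
      ≡⟨ cong (indicator (P (f 0)) +_) (count-cong m (avoids-f0 D0)) ⟩
    indicator (P (f 0)) + count (λ x → D (suc x) ∧ P′ (f (suc x))) m
      ≤⟨ +-monoʳ-≤ (indicator (P (f 0))) (tail P′) ⟩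
    indicator (P (f 0)) + count P′ N
      ≡⟨ count-remove N (f 0) P (f<N 0 z<s D0) ⟨
    count P N ∎

-- Multiplication and translation modulo N

<∸1⇒suc< : ∀ {j n} → j < n ∸ 1 → suc j < n
<∸1⇒suc< {n = suc n} j<n = s<s j<n

suc<⇒<∸1 : ∀ {j n} → suc j < n → j < n ∸ 1
suc<⇒<∸1 {n = suc n} (s<s j<n) = j<n

%-cong : ∀ {m m′ n n′} .{{_ : NonZero n}} .{{_ : NonZero n′}} → m ≡ m′ → n ≡ n′ → m % n ≡ m′ % n′
%-cong refl refl = refl

%-shift⇒∣ : ∀ a b N .{{_ : NonZero N}} → (a + b) % N ≡ a % N → N ∣ b
%-shift⇒∣ a b N e = divides ((a + b) / N ∸ a / N) (begin
  b                                   ≡⟨ m+n∸m≡n (a / N * N) b ⟨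
  (a / N * N + b) ∸ a / N * N         ≡⟨ cong (_∸ a / N * N) quotients ⟨
  (a + b) / N * N ∸ a / N * N         ≡⟨ *-distribʳ-∸ N ((a + b) / N) (a / N) ⟨
  ((a + b) / N ∸ a / N) * N           ∎)
  where
  open ≡-Reasoning
  quotients : (a + b) / N * N ≡ a / N * N + b
  quotients = +-cancelˡ-≡ (a % N) _ _ (begin
    a % N + (a + b) / N * N           ≡⟨ cong (_+ (a + b) / N * N) e ⟨
    (a + b) % N + (a + b) / N * N     ≡⟨ m≡m%n+[m/n]*n (a + b) N ⟨
    a + b                             ≡⟨ cong (_+ b) (m≡m%n+[m/n]*n a N) ⟩
    a % N + a / N * N + b             ≡⟨ +-assoc (a % N) _ b ⟩
    a % N + (a / N * N + b)           ∎)

affine-mod-injective-≤ : ∀ N .{{_ : NonZero N}} c j q → (∀ t → 0 < t → t < q → ¬ N ∣ j * t) →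
  ∀ x y → x ≤ y → y < q → (c + j * x) % N ≡ (c + j * y) % N → x ≡ y
affine-mod-injective-≤ N c j q no-multiple x y x≤y y<q e with y ∸ x in y∸x≡
... | zero  = ≤-antisym x≤y (m∸n≡0⇒m≤n y∸x≡)
... | suc t = ⊥-elim (no-multiple (suc t) z<s t<q
                (%-shift⇒∣ (c + j * x) (j * suc t) N (trans (cong (_% N) step) (sym e))))
  where
  t<q : suc t < q
  t<q = ≤-<-trans (≤-trans (≤-reflexive (sym y∸x≡)) (m∸n≤m y x)) y<q
  step : c + j * x + j * suc t ≡ c + j * y
  step = begin
    c + j * x + j * suc t       ≡⟨ +-assoc c _ _ ⟩
    c + (j * x + j * suc t)     ≡⟨ cong (c +_) (*-distribˡ-+ j x (suc t)) ⟨
    c + j * (x + suc t)         ≡⟨ cong (λ z → c + j * (x + z)) y∸x≡ ⟨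
    c + j * (x + (y ∸ x))       ≡⟨ cong (λ z → c + j * z) (m+[n∸m]≡n x≤y) ⟩
    c + j * y                   ∎
    where open ≡-Reasoning

affine-mod-injective : ∀ N .{{_ : NonZero N}} c j q → (∀ t → 0 < t → t < q → ¬ N ∣ j * t) →
  ∀ x y → x < q → y < q → (c + j * x) % N ≡ (c + j * y) % N → x ≡ y
affine-mod-injective N c j q no-multiple x y x<q y<q e with ≤-total x y
... | inj₁ x≤y = affine-mod-injective-≤ N c j q no-multiple x y x≤y y<q e
... | inj₂ y≤x = sym (affine-mod-injective-≤ N c j q no-multiple y x y≤x x<q (sym e))

coprime⇒∤* : ∀ {N j} → Coprime N j → ∀ t → 0 < t → t < N → ¬ N ∣ j * t
coprime⇒∤* N⊥j (suc t) _ t<N N∣jt = <⇒≱ t<N (∣⇒≤ (coprime-divisor N⊥j N∣jt))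

coprime-1 : ∀ N → Coprime N 1
coprime-1 N (_ , i∣1) = ∣1⇒≡1 i∣1

∃primeFactor : ∀ n → 2 ≤ n → Σ ℕ λ q → Prime q × q ∣ n
∃primeFactor n@(suc _) 2≤n = go (PrimeFactorisation.factors pf) (PrimeFactorisation.isFactorisation pf)
  (PrimeFactorisation.factorsPrime pf)
  where
  pf : PrimeFactorisation n
  pf = factorise n
  go : (qs : List ℕ) → n ≡ product qs → All Prime qs → Σ ℕ λ q → Prime q × q ∣ n
  go []       n≡1 _            = ⊥-elim (<⇒≢ 2≤n (sym n≡1))
  go (q ∷ qs) n≡∏qs (q-prime ∷ _) = q , q-prime , subst (q ∣_) (sym n≡∏qs) (m∣m*n (product qs))

primeFactors≥⇒coprime : ∀ N d j → ((q : ℕ) → Prime q → q ∣ N → d ≤ q) → 0 < j → j < d → Coprime N j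
primeFactors≥⇒coprime N d j factors≥d 0<j j<d {zero} (_ , 0∣j) = ⊥-elim (<⇒≢ 0<j (sym (0∣⇒≡0 0∣j)))
primeFactors≥⇒coprime N d j factors≥d 0<j j<d {1} _ = refl
primeFactors≥⇒coprime N d j factors≥d 0<j j<d {suc (suc i)} (i∣N , i∣j)
  with ∃primeFactor (suc (suc i)) (s≤s (s≤s z≤n))
... | q , q-prime , q∣i = ⊥-elim (<⇒≱ j<d (begin
  d         ≤⟨ factors≥d q q-prime (∣-trans q∣i i∣N) ⟩
  q         ≤⟨ ∣⇒≤ q∣i ⟩
  suc (suc i) ≤⟨ ∣⇒≤ {{>-nonZero 0<j}} i∣j ⟩
  j         ∎))
  where open ≤-Reasoning

count-affine≤ : ∀ N .{{_ : NonZero N}} q c j (D B : ℕ → Bool) → (∀ t → 0 < t → t < q → ¬ N ∣ j * t) →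
  count (λ x → D x ∧ B ((c + j * x) % N)) q ≤ count B N
count-affine≤ N q c j D B no-multiple = count-injective q N (λ x → (c + j * x) % N) D B
  (λ _ _ _ → m%n<n _ N) (λ x y x<q y<q _ _ → affine-mod-injective N c j q no-multiple x y x<q y<q)

count-translate≤ : ∀ N .{{_ : NonZero N}} c (B : ℕ → Bool) → count (λ y → B ((y + c) % N)) N ≤ count B N
count-translate≤ N c B = begin
  count (λ y → B ((y + c) % N)) N        ≡⟨ count-cong N (λ y _ → cong (λ z → B (z % N)) (reorder y)) ⟩
  count (λ y → B ((c + 1 * y) % N)) N    ≤⟨ count-affine≤ N N c 1 (λ _ → true) B (coprime⇒∤* (coprime-1 N)) ⟩
  count B N                              ∎
  where
  open ≤-Reasoning
  reorder : ∀ y → y + c ≡ c + 1 * y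
  reorder y = trans (+-comm y c) (cong (c +_) (sym (*-identityˡ y)))

-- Cubes spanned by two arithmetic progressions

-- Subsets of ℤ_N are handled as Boolean predicates on ℕ; member is false outside [0, n).
member : ∀ {n} → Subset n → ℕ → Bool
member []      _       = false
member (b ∷ v) zero    = b
member (b ∷ v) (suc k) = member v k

outside : ∀ {n} → Subset n → ℕ → Bool
outside A z = not (member A z)

∣p∣≡count-member : ∀ {n} (p : Subset n) → ∣ p ∣ ≡ count (member p) n
∣p∣≡count-member []          = refl
∣p∣≡count-member (true ∷ p)  = cong suc (∣p∣≡count-member p)
∣p∣≡count-member (false ∷ p) = ∣p∣≡count-member p

member⇒∈ : ∀ {n} (p : Subset n) (i : Fin n) → member p (toℕ i) ≡ true → i ∈ p
member⇒∈ (true ∷ p) fzero    _ = here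
member⇒∈ (b ∷ p)    (fsuc i) e = there (member⇒∈ p i e)

member%⇒mod∈ : ∀ {N} .{{_ : NonZero N}} (A : Subset N) s → member A (s % N) ≡ true → s mod N ∈ A
member%⇒mod∈ {N} A s e = member⇒∈ A _ (subst (λ z → member A z ≡ true) (sym (toℕ-fromℕ< (m%n<n s N))) e)

nonempty⇒∣p∣≥1 : ∀ {n} (p : Subset n) → Nonempty p → 1 ≤ ∣ p ∣
nonempty⇒∣p∣≥1 p (i , i∈p) = ≤-trans (≤-reflexive (sym (∣⁅x⁆∣≡1 i)))
  (p⊆q⇒∣p∣≤∣q∣ λ j∈⁅i⁆ → subst (_∈ p) (sym (x∈⁅y⁆⇒x≡y i j∈⁅i⁆)) i∈p)

subsetSumℕ-const : ∀ {n N} (x : Fin N) (I : Subset n) → subsetSumℕ (λ _ → x) I ≡ ∣ I ∣ * toℕ x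
subsetSumℕ-const x []          = refl
subsetSumℕ-const x (true ∷ I)  = cong (toℕ x +_) (subsetSumℕ-const x I)
subsetSumℕ-const x (false ∷ I) = subsetSumℕ-const x I

cube-of-progressions : ∀ {N} .{{_ : NonZero N}} d' (A : Subset N) (y x : Fin N) →
  (∀ k → 1 ≤ k → k ≤ d' → member A ((k * toℕ x) % N) ≡ true) →
  (∀ k → k ≤ d' → member A ((toℕ y + k * toℕ x) % N) ≡ true) →
  Σ (Fin (suc d') → Fin N) λ a → CubeIn a A
cube-of-progressions {N} d' A y x multiples∈A shifted∈A = a , a-cube
  where
  a : Fin (suc d') → Fin N
  a fzero    = y
  a (fsuc _) = x
  a-cube : CubeIn a A
  a-cube (true ∷ I) _ = member%⇒mod∈ A _
    (subst (λ s → member A ((toℕ y + s) % N) ≡ true) (sym (subsetSumℕ-const x I)) (shifted∈A ∣ I ∣ (∣p∣≤n I)))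
  a-cube (false ∷ I) I≠∅ = member%⇒mod∈ A _
    (subst (λ s → member A (s % N) ≡ true) (sym (subsetSumℕ-const x I))
      (multiples∈A ∣ I ∣ (nonempty⇒∣p∣≥1 (false ∷ I) I≠∅) (∣p∣≤n I)))

cubeFree⇒0∉ : ∀ N .{{_ : NonZero N}} d' (A : Subset N) → CubeFree (suc d') A → outside A 0 ≡ true
cubeFree⇒0∉ N d' A cubeFree with member A 0 in 0∈A
... | false = refl
... | true  = ⊥-elim (cubeFree (cube-of-progressions d' A zeroF zeroF
                  (λ k _ _ → at-0 (trans (cong (k *_) toℕ-zeroF) (*-zeroʳ k)))
                  (λ k _ → at-0 (trans (cong₂ (λ y x → y + k * x) toℕ-zeroF toℕ-zeroF) (*-zeroʳ k)))))
  where
  0<N : 0 < N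
  0<N = >-nonZero⁻¹ N
  zeroF : Fin N
  zeroF = fromℕ< 0<N
  toℕ-zeroF : toℕ zeroF ≡ 0
  toℕ-zeroF = toℕ-fromℕ< 0<N
  at-0 : ∀ {y} → y ≡ 0 → member A (y % N) ≡ true
  at-0 refl rewrite m<n⇒m%n≡m 0<N = 0∈A

-- Steps whose multiples avoid a sparse set

AvoidingStep : ∀ N .{{_ : NonZero N}} → ℕ → (ℕ → Bool) → Set
AvoidingStep N d' B = Σ ℕ λ x → x < N × anyBelow d' (λ j → B ((suc j * x) % N)) ≡ false

count-translates-union< : ∀ N .{{_ : NonZero N}} m x (B : ℕ → Bool) → m * count B N < N →
  count (λ y → anyBelow m (λ j → B ((y + j * x) % N))) N < count (λ _ → true) N
count-translates-union< N m x B sparse = begin-strict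
  count (λ y → anyBelow m (λ j → B ((y + j * x) % N))) N
    ≤⟨ count-anyBelow N m (λ _ → true) (λ j y → B ((y + j * x) % N)) ⟩
  sumBelow m (λ j → count (λ y → B ((y + j * x) % N)) N)
    ≤⟨ sumBelow-mono m (λ j _ → count-translate≤ N (j * x) B) ⟩
  sumBelow m (λ _ → count B N)   ≡⟨ sumBelow-const m _ ⟩
  m * count B N                  <⟨ sparse ⟩
  N                              ≡⟨ count-const-true N ⟨
  count (λ _ → true) N           ∎
  where open ≤-Reasoning

cubeFree⇒¬avoidingStep : ∀ N .{{_ : NonZero N}} d' (A : Subset N) → CubeFree (suc d') A →
  suc d' * count (outside A) N < N → ¬ AvoidingStep N d' (outside A)
cubeFree⇒¬avoidingStep N d' A cubeFree sparse (x , x<N , x-avoids)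
  with count-<⇒separating N _ _ (count-translates-union< N (suc d') x _ sparse)
... | y , y<N , _ , y-avoids =
  cubeFree (cube-of-progressions d' A (fromℕ< y<N) (fromℕ< x<N) multiples∈A shifted∈A)
  where
  multiples∈A : ∀ k → 1 ≤ k → k ≤ d' → member A ((k * toℕ (fromℕ< x<N)) % N) ≡ true
  multiples∈A (suc k) _ k<d' rewrite toℕ-fromℕ< x<N =
    not-injective (anyBelow-false d' _ x-avoids k k<d')
  shifted∈A : ∀ k → k ≤ d' → member A ((toℕ (fromℕ< y<N) + k * toℕ (fromℕ< x<N)) % N) ≡ true
  shifted∈A k k≤d' rewrite toℕ-fromℕ< x<N | toℕ-fromℕ< y<N =
    not-injective (anyBelow-false (suc d') (λ j → outside A ((y + j * x) % N)) y-avoids k (s≤s k≤d'))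

avoidingStep-fromSum : ∀ N .{{_ : NonZero N}} d' (B : ℕ → Bool) →
  sumBelow d' (λ j → count (λ x → B ((suc j * x) % N)) N) < N → AvoidingStep N d' B
avoidingStep-fromSum N d' B small = avoiding (count-<⇒separating N _ _ few-bad-steps)
  where
  few-bad-steps : count (λ x → anyBelow d' (λ j → B ((suc j * x) % N))) N < count (λ _ → true) N
  few-bad-steps = begin-strict
    count (λ x → anyBelow d' (λ j → B ((suc j * x) % N))) N
      ≤⟨ count-anyBelow N d' (λ _ → true) (λ j x → B ((suc j * x) % N)) ⟩
    sumBelow d' (λ j → count (λ x → B ((suc j * x) % N)) N)   <⟨ small ⟩
    N                                                         ≡⟨ count-const-true N ⟨
    count (λ _ → true) N                                      ∎
    where open ≤-Reasoning
  avoiding : Separating N _ (λ _ → true) → AvoidingStep N d' B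
  avoiding (x , x<N , _ , x-avoids) = x , x<N , x-avoids

avoidingStep-primeFactors≥ : ∀ N .{{_ : NonZero N}} d' (B : ℕ → Bool) →
  ((q : ℕ) → Prime q → q ∣ N → suc d' ≤ q) → suc d' * count B N < N → AvoidingStep N d' B
avoidingStep-primeFactors≥ N d' B factors≥d sparse = avoidingStep-fromSum N d' B (begin-strict
  sumBelow d' (λ j → count (λ x → B ((suc j * x) % N)) N)
    ≤⟨ sumBelow-mono d' (λ j j<d' → count-affine≤ N N 0 (suc j) (λ _ → true) B
         (coprime⇒∤* (primeFactors≥⇒coprime N (suc d') (suc j) factors≥d z<s (s≤s j<d')))) ⟩
  sumBelow d' (λ _ → count B N)     ≡⟨ sumBelow-const d' _ ⟩
  d' * count B N                    ≤⟨ *-monoˡ-≤ _ (n≤1+n d') ⟩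
  suc d' * count B N                <⟨ sparse ⟩
  N                                 ∎)
  where open ≤-Reasoning

count-double≤ : ∀ N .{{_ : NonZero N}} (B : ℕ → Bool) → count (λ x → B ((2 * x) % N)) N ≤ 2 * count B N
count-double≤ N B with 2 ∣? N
... | yes (divides q N≡q*2) = begin
  count P N            ≡⟨ cong (count P) (trans N≡q*2 (*-comm q 2)) ⟩
  count P (2 * q)      ≡⟨ count-periodic 2 q P period-q ⟩
  2 * count P q        ≤⟨ *-monoʳ-≤ 2 (count-affine≤ N q 0 2 (λ _ → true) B injective-below-q) ⟩
  2 * count B N        ∎
  where
  open ≤-Reasoning
  P : ℕ → Bool
  P x = B ((2 * x) % N)
  N∣2q : N ∣ 2 * q
  N∣2q = subst (N ∣_) (trans N≡q*2 (*-comm q 2)) ∣-refl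
  period-q : ∀ x → P (x + q) ≡ P x
  period-q x = cong B (trans (cong (_% N) (*-distribˡ-+ 2 x q)) (%-remove-+ʳ (2 * x) N∣2q))
  injective-below-q : ∀ t → 0 < t → t < q → ¬ N ∣ 2 * t
  injective-below-q (suc t) _ t<q N∣2t = <⇒≱ t<q (*-cancelʳ-≤ q (suc t) 2 (begin
    q * 2           ≡⟨ N≡q*2 ⟨
    N               ≤⟨ ∣⇒≤ N∣2t ⟩
    2 * suc t       ≡⟨ *-comm 2 (suc t) ⟩
    suc t * 2       ∎))
... | no 2∤N = ≤-trans
  (count-affine≤ N N 0 2 (λ _ → true) B (coprime⇒∤* (primeFactors≥⇒coprime N 3 2 factors≥3 z<s ≤-refl)))
  (m≤n*m _ 2)
  where
  factors≥3 : (q : ℕ) → Prime q → q ∣ N → 3 ≤ q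
  factors≥3 q q-prime q∣N = ≤∧≢⇒< (nonTrivial⇒n>1 q {{prime⇒nonTrivial q-prime}})
    (λ 2≡q → 2∤N (subst (_∣ N) (sym 2≡q) q∣N))

avoidingStep-3 : ∀ N .{{_ : NonZero N}} (B : ℕ → Bool) → 3 * count B N < N → AvoidingStep N 2 B
avoidingStep-3 N B sparse = avoidingStep-fromSum N 2 B (begin-strict
  count (λ x → B ((1 * x) % N)) N + (count (λ x → B ((2 * x) % N)) N + 0)
    ≤⟨ +-mono-≤ (count-affine≤ N N 0 1 (λ _ → true) B (coprime⇒∤* (coprime-1 N)))
                (+-monoˡ-≤ 0 (count-double≤ N B)) ⟩
  count B N + (2 * count B N + 0)   ≡⟨ cong (count B N +_) (+-identityʳ (2 * count B N)) ⟩
  3 * count B N                     <⟨ sparse ⟩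
  N                                 ∎)
  where open ≤-Reasoning

-- Prime-power moduli

module PrimePower {p} (p-prime : Prime p) where

  instance
    p-nonZero : NonZero p
    p-nonZero = nonTrivial⇒nonZero p {{prime⇒nonTrivial p-prime}}

  1<p : 1 < p
  1<p = nonTrivial⇒n>1 p {{prime⇒nonTrivial p-prime}}

  ∤⇒coprime : ∀ {d} → ¬ p ∣ d → Coprime d p
  ∤⇒coprime p∤d (i∣d , i∣p) with prime⇒irreducible p-prime i∣p
  ... | inj₁ i≡1  = i≡1
  ... | inj₂ refl = ⊥-elim (p∤d i∣d)

  ∣p^k⇒≡p^m : ∀ k d → d ∣ p ^ k → Σ ℕ λ m → m ≤ k × d ≡ p ^ m
  ∣p^k⇒≡p^m zero    d d∣1 = 0 , z≤n , ∣1⇒≡1 d∣1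
  ∣p^k⇒≡p^m (suc k) d d∣p^k+1 with p ∣? d
  ... | yes (divides e refl)
    with ∣p^k⇒≡p^m k e (*-cancelʳ-∣ p (subst (e * p ∣_) (*-comm p (p ^ k)) d∣p^k+1))
  ...   | m , m≤k , refl = suc m , s≤s m≤k , *-comm (p ^ m) p
  ∣p^k⇒≡p^m (suc k) d d∣p^k+1 | no p∤d
    with ∣p^k⇒≡p^m k d (coprime-divisor (∤⇒coprime p∤d) d∣p^k+1)
  ...   | m , m≤k , d≡p^m = m , m≤n⇒m≤1+n m≤k , d≡p^m

  ∤⇒p^-coprime : ∀ k j → ¬ p ∣ j → Coprime (p ^ k) j
  ∤⇒p^-coprime k j p∤j (i∣p^k , i∣j) with ∣p^k⇒≡p^m k _ i∣p^k
  ... | zero  , _ , i≡1   = i≡1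
  ... | suc m , _ , refl  = ⊥-elim (p∤j (∣-trans (m∣m*n (p ^ m)) i∣j))

  unit : ℕ → Bool
  unit x = not (does (p ∣? x))

  ∣⇒unit≡false : ∀ {x} → p ∣ x → unit x ≡ false
  ∣⇒unit≡false {x} p∣x = cong not (dec-true (p ∣? x) p∣x)

  ∤⇒unit≡true : ∀ {x} → ¬ p ∣ x → unit x ≡ true
  ∤⇒unit≡true {x} p∤x = cong not (dec-false (p ∣? x) p∤x)

  unit≡true⇒∤ : ∀ {x} → unit x ≡ true → ¬ p ∣ x
  unit≡true⇒∤ unit-x p∣x = contradiction (trans (sym (∣⇒unit≡false p∣x)) unit-x) λ ()

  unit≡false⇒∣ : ∀ {x} → unit x ≡ false → p ∣ x
  unit≡false⇒∣ {x} non-unit with p ∣? x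
  ... | yes p∣x = p∣x
  unit≡false⇒∣ () | no _

  unit-+-∣ : ∀ x {q} → p ∣ q → unit (x + q) ≡ unit x
  unit-+-∣ x {q} p∣q with p ∣? x
  ... | yes p∣x = ∣⇒unit≡false (∣m∣n⇒∣m+n p∣x p∣q)
  ... | no  p∤x = ∤⇒unit≡true (λ p∣x+q → p∤x (∣m+n∣m⇒∣n (subst (p ∣_) (+-comm x q) p∣x+q) p∣q))

  count-nonunits-below-p : ∀ (B : ℕ → Bool) → count (λ z → not (unit z) ∧ B z) p ≡ indicator (B 0)
  count-nonunits-below-p B = begin
    count P p                                           ≡⟨ cong (count P) (m+[n∸m]≡n (<⇒≤ 1<p)) ⟨
    indicator (P 0) + count (λ x → P (suc x)) (p ∸ 1)   ≡⟨ cong₂ _+_ at-0 (count-cong (p ∸ 1) below-p) ⟩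
    indicator (B 0) + count (λ _ → false) (p ∸ 1)       ≡⟨ cong (indicator (B 0) +_) (count-const-false (p ∸ 1)) ⟩
    indicator (B 0) + 0                                 ≡⟨ +-identityʳ _ ⟩
    indicator (B 0)                                     ∎
    where
    open ≡-Reasoning
    P : ℕ → Bool
    P z = not (unit z) ∧ B z
    at-0 : indicator (P 0) ≡ indicator (B 0)
    at-0 = cong (λ u → indicator (not u ∧ B 0)) (∣⇒unit≡false (p ∣0))
    below-p : ∀ x → x < p ∸ 1 → P (suc x) ≡ false
    below-p x x<p-1 = cong (λ u → not u ∧ B (suc x))
      (∤⇒unit≡true λ p∣1+x → <⇒≱ x<p-1 (∸-monoˡ-≤ 1 (∣⇒≤ p∣1+x)))

  count-nonunits : ∀ M (B : ℕ → Bool) → count (λ z → not (unit z) ∧ B z) (M * p) ≡ count (λ y → B (p * y)) M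
  count-nonunits zero    B = refl
  count-nonunits (suc M) B = begin
    count P (p + M * p)                                        ≡⟨ count-+ p (M * p) P ⟩
    count P p + count (λ x → P (p + x)) (M * p)                ≡⟨ cong₂ _+_ (count-nonunits-below-p B)
                                                                    (count-cong (M * p) λ x _ → shift x) ⟩
    indicator (B 0) + count (λ x → not (unit x) ∧ B (p + x)) (M * p)
      ≡⟨ cong₂ _+_ (cong (λ z → indicator (B z)) (sym (*-zeroʳ p))) (count-nonunits M (λ z → B (p + z))) ⟩
    indicator (B (p * 0)) + count (λ y → B (p + p * y)) M    ≡⟨ cong (indicator (B (p * 0)) +_)
                                                                    (count-cong M λ y _ → cong B (*-suc p y)) ⟨
    count (λ y → B (p * y)) (suc M)                            ∎
    where
    open ≡-Reasoning
    P : ℕ → Bool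
    P z = not (unit z) ∧ B z
    shift : ∀ x → P (p + x) ≡ (not (unit x) ∧ B (p + x))
    shift x = cong (λ u → not u ∧ B (p + x)) (trans (cong unit (+-comm p x)) (unit-+-∣ x ∣-refl))

  count-units : ∀ m → count unit (p ^ suc m) ≡ p ^ m * (p ∸ 1)
  count-units m = +-cancelˡ-≡ (p ^ m) _ _ (begin
    p ^ m + count unit (p ^ suc m)                        ≡⟨ cong (_+ count unit (p ^ suc m)) nonunits ⟨
    count (λ x → not (unit x)) (p ^ suc m) + count unit (p ^ suc m)  ≡⟨ count-not+count (p ^ suc m) unit ⟩
    p * p ^ m                                             ≡⟨ *-comm p (p ^ m) ⟩
    p ^ m * p                                             ≡⟨ cong (p ^ m *_) (m+[n∸m]≡n (<⇒≤ 1<p)) ⟨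
    p ^ m * (1 + (p ∸ 1))                                 ≡⟨ *-distribˡ-+ (p ^ m) 1 (p ∸ 1) ⟩
    p ^ m * 1 + p ^ m * (p ∸ 1)                           ≡⟨ cong (_+ p ^ m * (p ∸ 1)) (*-identityʳ (p ^ m)) ⟩
    p ^ m + p ^ m * (p ∸ 1)                               ∎)
    where
    open ≡-Reasoning
    nonunits : count (λ x → not (unit x)) (p ^ suc m) ≡ p ^ m
    nonunits = begin
      count (λ x → not (unit x)) (p ^ suc m)              ≡⟨ count-cong (p ^ suc m) (λ x _ → ∧-identityʳ _) ⟨
      count (λ x → not (unit x) ∧ true) (p ^ suc m)       ≡⟨ cong (count _) (*-comm p (p ^ m)) ⟩
      count (λ x → not (unit x) ∧ true) (p ^ m * p)       ≡⟨ count-nonunits (p ^ m) (λ _ → true) ⟩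
      count (λ _ → true) (p ^ m)                          ≡⟨ count-const-true (p ^ m) ⟩
      p ^ m                                               ∎

  -- Reduction modulo p ^ k with a built-in NonZero instance, so that statements about these moduli
  -- carry no instance argument (instance search cannot find NonZero (p ^ k) for an unknown k).
  _%p^_ : ℕ → ℕ → ℕ
  x %p^ k = x % p ^ k
    where
    instance
      p^k-nonZero : NonZero (p ^ k)
      p^k-nonZero = m^n≢0 p k

  unit-*-%p^ : ∀ k {j x} → unit j ≡ true → unit x ≡ true → unit ((j * x) %p^ suc k) ≡ true
  unit-*-%p^ k {j} {x} unit-j unit-x = ∤⇒unit≡true λ p∣jx%N →
    [ unit≡true⇒∤ unit-j , unit≡true⇒∤ unit-x ]′
      (euclidsLemma j x p-prime (∣n∣m%n⇒∣m {{m^n≢0 p (suc k)}} (m∣m*n (p ^ k)) p∣jx%N))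

  count-unit-multiples≤ : ∀ k m (B : ℕ → Bool) →
    count (λ x → unit x ∧ anyBelow (p ^ suc m) (λ j → unit j ∧ B ((j * x) %p^ suc k))) (p ^ suc k)
    ≤ p ^ m * (p ∸ 1) * count (λ z → unit z ∧ B z) (p ^ suc k)
  count-unit-multiples≤ k m B = begin
    count (λ x → unit x ∧ anyBelow (p ^ suc m) (λ j → unit j ∧ B ((j * x) % N))) N
      ≤⟨ count-anyBelow N (p ^ suc m) unit (λ j x → unit j ∧ B ((j * x) % N)) ⟩
    sumBelow (p ^ suc m) (λ j → count (λ x → unit x ∧ (unit j ∧ B ((j * x) % N))) N)
      ≤⟨ sumBelow-mono (p ^ suc m) (λ j _ → multiplier j) ⟩
    sumBelow (p ^ suc m) (λ j → if unit j then count B′ N else 0)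
      ≡⟨ sumBelow-if (p ^ suc m) unit (count B′ N) ⟩
    count unit (p ^ suc m) * count B′ N
      ≡⟨ cong (_* count B′ N) (count-units m) ⟩
    p ^ m * (p ∸ 1) * count B′ N ∎
    where
    open ≤-Reasoning
    N : ℕ
    N = p ^ suc k
    instance
      N-nonZero : NonZero N
      N-nonZero = m^n≢0 p (suc k)
    B′ : ℕ → Bool
    B′ z = unit z ∧ B z
    multiplier : ∀ j →
      count (λ x → unit x ∧ (unit j ∧ B ((j * x) % N))) N ≤ (if unit j then count B′ N else 0)
    multiplier j = by-unit-j (unit j) refl
      where
      stays-unit : unit j ≡ true → ∀ x → (unit x ∧ B ((j * x) % N)) ≡ (unit x ∧ B′ ((j * x) % N))
      stays-unit unit-j x = ∧-cong-true (unit x) λ unit-x →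
        cong (_∧ B ((j * x) % N)) (sym (unit-*-%p^ k unit-j unit-x))
      by-unit-j : ∀ b → unit j ≡ b →
        count (λ x → unit x ∧ (b ∧ B ((j * x) % N))) N ≤ (if b then count B′ N else 0)
      by-unit-j false _ = ≤-reflexive (trans (count-cong N λ x _ → ∧-zeroʳ (unit x)) (count-const-false N))
      by-unit-j true unit-j = begin
        count (λ x → unit x ∧ B ((j * x) % N)) N          ≡⟨ count-cong N (λ x _ → stays-unit unit-j x) ⟩
        count (λ x → unit x ∧ B′ ((0 + j * x) % N)) N
          ≤⟨ count-affine≤ N N 0 j unit B′ (coprime⇒∤* (∤⇒p^-coprime (suc k) j (unit≡true⇒∤ unit-j))) ⟩
        count B′ N                                        ∎

  p*-%p^ : ∀ k y → p * (y %p^ k) ≡ (p * y) %p^ suc k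
  p*-%p^ k y = begin
    p * (y % p ^ k)          ≡⟨ *-comm p _ ⟩
    (y % p ^ k) * p          ≡⟨ m%n*o≡m*o%[n*o] y (p ^ k) p ⟩
    (y * p) % (p ^ k * p)    ≡⟨ %-cong (*-comm y p) (*-comm (p ^ k) p) ⟩
    (p * y) % (p * p ^ k)    ∎
    where
    open ≡-Reasoning
    instance
      p^k-nonZero : NonZero (p ^ k)
      p^k-nonZero = m^n≢0 p k
      p^k*p-nonZero : NonZero (p ^ k * p)
      p^k*p-nonZero = m*n≢0 (p ^ k) p
      p^1+k-nonZero : NonZero (p ^ suc k)
      p^1+k-nonZero = m^n≢0 p (suc k)

  unitHit : ℕ → ℕ → (ℕ → Bool) → ℕ → Bool
  unitHit k m B x = anyBelow (p ^ suc m) (λ j → unit j ∧ B ((j * x) %p^ suc k))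

  multipleHit : ℕ → ℕ → (ℕ → Bool) → ℕ → Bool
  multipleHit k m B x = anyBelow (p ^ m ∸ 1) (λ i → B (p * ((suc i * x) %p^ k)))

  hit⇒unitHit∨multipleHit : ∀ k m B x → anyBelow (p ^ suc m ∸ 1) (λ j → B ((suc j * x) %p^ suc k)) ≡ true →
                            unitHit k m B x ∨ multipleHit k m B x ≡ true
  hit⇒unitHit∨multipleHit k m B x hit with anyBelow-witness _ _ hit
  ... | j , j<M , Bj with unit (suc j) in unit-j
  ...   | true  = cong (_∨ multipleHit k m B x)
                    (anyBelow-true (p ^ suc m) (λ j → unit j ∧ B ((j * x) %p^ suc k)) (suc j) (<∸1⇒suc< j<M)
                      (trans (cong (_∧ B ((suc j * x) %p^ suc k)) unit-j) Bj))
  ...   | false with unit≡false⇒∣ unit-j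
  ...     | divides (suc i) 1+j≡[1+i]p = trans (cong (unitHit k m B x ∨_) multiple-hit) (∨-zeroʳ _)
    where
    same-point : p * ((suc i * x) %p^ k) ≡ (suc j * x) %p^ suc k
    same-point = begin
      p * ((suc i * x) %p^ k)     ≡⟨ p*-%p^ k (suc i * x) ⟩
      (p * (suc i * x)) %p^ suc k ≡⟨ cong (_%p^ suc k) (*-assoc p (suc i) x) ⟨
      (p * suc i * x) %p^ suc k   ≡⟨ cong (λ z → (z * x) %p^ suc k) (trans (*-comm p (suc i)) (sym 1+j≡[1+i]p)) ⟩
      (suc j * x) %p^ suc k       ∎
      where open ≡-Reasoning
    i<p^m-1 : i < p ^ m ∸ 1
    i<p^m-1 = suc<⇒<∸1 (*-cancelʳ-< p (suc i) (p ^ m) (begin-strict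
      suc i * p     ≡⟨ 1+j≡[1+i]p ⟨
      suc j         <⟨ <∸1⇒suc< j<M ⟩
      p * p ^ m     ≡⟨ *-comm p (p ^ m) ⟩
      p ^ m * p     ∎))
      where open ≤-Reasoning
    multiple-hit : multipleHit k m B x ≡ true
    multiple-hit = anyBelow-true (p ^ m ∸ 1) (λ i → B (p * ((suc i * x) %p^ k))) i i<p^m-1
      (trans (cong B same-point) Bj)

  badUnit : ℕ → ℕ → (ℕ → Bool) → ℕ → Bool
  badUnit k m B x = unit x ∧ anyBelow (p ^ suc m ∸ 1) (λ j → B ((suc j * x) %p^ suc k))

  badUnit-periodic : ∀ k m B x → badUnit k m B (x + p ^ suc k) ≡ badUnit k m B x
  badUnit-periodic k m B x = cong₂ _∧_ (unit-+-∣ x (m∣m*n (p ^ k)))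
    (anyBelow-cong (p ^ suc m ∸ 1) λ j → cong B (begin
      (suc j * (x + N)) % N              ≡⟨ cong (_% N) (*-distribˡ-+ (suc j) x N) ⟩
      (suc j * x + suc j * N) % N        ≡⟨ [m+kn]%n≡m%n (suc j * x) (suc j) N ⟩
      (suc j * x) % N                    ∎))
    where
    open ≡-Reasoning
    N : ℕ
    N = p ^ suc k
    instance
      N-nonZero : NonZero N
      N-nonZero = m^n≢0 p (suc k)

  count-split-units : ∀ k (B : ℕ → Bool) →
    count B (p ^ suc k) ≡ count (λ z → unit z ∧ B z) (p ^ suc k) + count (λ y → B (p * y)) (p ^ k)
  count-split-units k B = trans (count-split (p ^ suc k) unit B)
    (cong (count (λ z → unit z ∧ B z) (p ^ suc k) +_)
      (trans (cong (count (λ z → not (unit z) ∧ B z)) (*-comm p (p ^ k))) (count-nonunits (p ^ k) B)))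

  count-badUnit≤ : ∀ k m (B : ℕ → Bool) → m ≤ k → B 0 ≡ true →
    count (badUnit k m B) (p ^ suc k) ≤ p ^ m * (p ∸ 1) * (count B (p ^ suc k) ∸ 1)
  count-multipleHit≤ : ∀ k m (B : ℕ → Bool) → m ≤ k → B 0 ≡ true →
    count (λ x → unit x ∧ multipleHit k m B x) (p ^ suc k)
    ≤ p ^ m * (p ∸ 1) * (count (λ y → B (p * y)) (p ^ k) ∸ 1)

  count-badUnit≤ k m B m≤k B0 = begin
    count (badUnit k m B) N
      ≤⟨ count-mono N (λ x _ → split x) ⟩
    count (λ x → (unit x ∧ unitHit k m B x) ∨ (unit x ∧ multipleHit k m B x)) N
      ≤⟨ count-∨ N _ _ ⟩
    count (λ x → unit x ∧ unitHit k m B x) N + count (λ x → unit x ∧ multipleHit k m B x) N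
      ≤⟨ +-mono-≤ (count-unit-multiples≤ k m B) (count-multipleHit≤ k m B m≤k B0) ⟩
    φ * b₁ + φ * (b₂ ∸ 1)          ≡⟨ *-distribˡ-+ φ b₁ (b₂ ∸ 1) ⟨
    φ * (b₁ + (b₂ ∸ 1))            ≡⟨ cong (φ *_) (+-∸-assoc b₁ b₂≥1) ⟨
    φ * (b₁ + b₂ ∸ 1)              ≡⟨ cong (λ b → φ * (b ∸ 1)) (count-split-units k B) ⟨
    φ * (count B N ∸ 1)            ∎
    where
    open ≤-Reasoning
    N φ b₁ b₂ : ℕ
    N = p ^ suc k
    φ = p ^ m * (p ∸ 1)
    b₁ = count (λ z → unit z ∧ B z) N
    b₂ = count (λ y → B (p * y)) (p ^ k)
    b₂≥1 : 1 ≤ b₂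
    b₂≥1 = count-positive (p ^ k) _ 0 (m^n>0 p k) (trans (cong B (*-zeroʳ p)) B0)
    split : ∀ x → badUnit k m B x ≡ true → ((unit x ∧ unitHit k m B x) ∨ (unit x ∧ multipleHit k m B x)) ≡ true
    split x bad with unit x
    ... | true = hit⇒unitHit∨multipleHit k m B x bad

  count-multipleHit≤ k zero B _ _ = ≤-trans (≤-reflexive (trans
    (count-cong (p ^ suc k) λ x _ → ∧-zeroʳ (unit x)) (count-const-false (p ^ suc k)))) z≤n
  count-multipleHit≤ (suc k) (suc m) B (s≤s m≤k) B0 = begin
    count (badUnit k m B₂) (p * p ^ suc k)   ≡⟨ count-periodic p (p ^ suc k) _ (badUnit-periodic k m B₂) ⟩
    p * count (badUnit k m B₂) (p ^ suc k)   ≤⟨ *-monoʳ-≤ p (count-badUnit≤ k m B₂ m≤k B₂0) ⟩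
    p * (p ^ m * (p ∸ 1) * (b₂ ∸ 1))         ≡⟨ *-assoc p (p ^ m * (p ∸ 1)) _ ⟨
    p * (p ^ m * (p ∸ 1)) * (b₂ ∸ 1)         ≡⟨ cong (_* (b₂ ∸ 1)) (*-assoc p (p ^ m) (p ∸ 1)) ⟨
    p ^ suc m * (p ∸ 1) * (b₂ ∸ 1)           ∎
    where
    open ≤-Reasoning
    B₂ : ℕ → Bool
    B₂ y = B (p * y)
    B₂0 : B₂ 0 ≡ true
    B₂0 = trans (cong B (*-zeroʳ p)) B0
    b₂ : ℕ
    b₂ = count B₂ (p ^ suc k)

  avoidingStep-primePower : ∀ N .{{_ : NonZero N}} k m (B : ℕ → Bool) → N ≡ p ^ k → m ≤ k → B 0 ≡ true →
    p ^ m * count B N < N → AvoidingStep N (p ^ m ∸ 1) B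
  avoidingStep-primePower N k zero B _ _ _ _ = 0 , >-nonZero⁻¹ N , refl
  avoidingStep-primePower N (suc k) (suc m) B refl (s≤s m≤k) B0 sparse =
    avoiding (count-<⇒separating N _ _ few-bad-units)
    where
    open ≤-Reasoning
    b : ℕ
    b = count B N
    instance
      p-1-nonZero : NonZero (p ∸ 1)
      p-1-nonZero = >-nonZero (m<n⇒0<n∸m 1<p)
    shrunk : p ^ m * (b ∸ 1) < p ^ k
    shrunk = *-cancelˡ-< p _ _ (begin-strict
      p * (p ^ m * (b ∸ 1))     ≡⟨ *-assoc p (p ^ m) (b ∸ 1) ⟨
      p ^ suc m * (b ∸ 1)       ≤⟨ *-monoʳ-≤ (p ^ suc m) (m∸n≤m b 1) ⟩
      p ^ suc m * b             <⟨ sparse ⟩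
      p ^ suc k                 ∎)
    few-bad-units : count (badUnit k m B) N < count unit N
    few-bad-units = begin-strict
      count (badUnit k m B) N           ≤⟨ count-badUnit≤ k m B m≤k B0 ⟩
      p ^ m * (p ∸ 1) * (b ∸ 1)         ≡⟨ *-assoc (p ^ m) (p ∸ 1) (b ∸ 1) ⟩
      p ^ m * ((p ∸ 1) * (b ∸ 1))       ≡⟨ cong (p ^ m *_) (*-comm (p ∸ 1) (b ∸ 1)) ⟩
      p ^ m * ((b ∸ 1) * (p ∸ 1))       ≡⟨ *-assoc (p ^ m) (b ∸ 1) (p ∸ 1) ⟨
      p ^ m * (b ∸ 1) * (p ∸ 1)         <⟨ *-monoˡ-< (p ∸ 1) shrunk ⟩
      p ^ k * (p ∸ 1)                   ≡⟨ count-units k ⟨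
      count unit N                      ∎
    avoiding : Separating N (badUnit k m B) unit → AvoidingStep N (p ^ suc m ∸ 1) B
    avoiding (x , x<N , unit-x , good-x) = x , x<N ,
      subst (λ u → u ∧ anyBelow (p ^ suc m ∸ 1) (λ j → B ((suc j * x) %p^ suc k)) ≡ false) unit-x good-x

open PrimePower using (∣p^k⇒≡p^m; avoidingStep-primePower)

complement-sparse : ∀ {N} d' (A : Subset N) → ¬ suc d' * ∣ A ∣ ≤ d' * N →
  suc d' * count (outside A) N < N
complement-sparse {N} d' A dense =
  subst (suc d' * b <_) b+a≡N (+-cancelʳ-< (d' * (b + a)) (suc d' * b) (b + a) (begin-strict
    suc d' * b + d' * (b + a)      <⟨ +-monoʳ-< (suc d' * b) (subst₂ (λ M a → d' * M < suc d' * a)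
                                        (sym b+a≡N) (∣p∣≡count-member A) (≰⇒> dense)) ⟩
    suc d' * b + suc d' * a        ≡⟨ *-distribˡ-+ (suc d') b a ⟨
    suc d' * (b + a)               ∎))
  where
  open ≤-Reasoning
  a : ℕ
  a = count (member A) N
  b : ℕ
  b = count (outside A) N
  b+a≡N : b + a ≡ N
  b+a≡N = count-not+count N (member A)

avoidingStep-exists : ∀ N .{{_ : NonZero N}} d' (B : ℕ → Bool) → B 0 ≡ true → suc d' ∣ N →
  (suc d' ≡ 3
    ⊎ (Prime (suc d') × ((p : ℕ) → Prime p → p ∣ N → suc d' ≤ p))
    ⊎ Σ ℕ (λ p → Prime p × Σ ℕ (λ k → N ≡ p ^ k))) →
  suc d' * count B N < N → AvoidingStep N d' B
avoidingStep-exists N .2 B _ _ (inj₁ refl) = avoidingStep-3 N B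
avoidingStep-exists N d' B _ _ (inj₂ (inj₁ (_ , factors≥d))) = avoidingStep-primeFactors≥ N d' B factors≥d
avoidingStep-exists N d' B B0 d∣N (inj₂ (inj₂ (p , p-prime , k , N≡p^k))) sparse
  with ∣p^k⇒≡p^m p-prime k (suc d') (subst (suc d' ∣_) N≡p^k d∣N)
... | m , m≤k , d≡p^m = subst (λ e → AvoidingStep N e B) (cong (_∸ 1) (sym d≡p^m))
  (avoidingStep-primePower p-prime N k m B N≡p^k m≤k B0 (subst (λ d → d * count B N < N) d≡p^m sparse))

mainTheorem1 : (n d : ℕ) → let N = suc n in
    1 ≤ d → d ∣ N → (A : Subset N) → CubeFree d A →
    (d ≡ 3
      ⊎ (Prime d × ((p : ℕ) → Prime p → p ∣ N → d ≤ p))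
      ⊎ Σ ℕ (λ p → Prime p × Σ ℕ (λ k → N ≡ p ^ k))) →
    d * ∣ A ∣ ≤ (d ∸ 1) * N
mainTheorem1 n (suc d') _ d∣N A cubeFree cases with suc d' * ∣ A ∣ ≤? d' * suc n
... | yes bound = bound
... | no ¬bound = ⊥-elim (cubeFree⇒¬avoidingStep (suc n) d' A cubeFree sparse
                    (avoidingStep-exists (suc n) d' (outside A) 0∉A d∣N cases sparse))
  where
  sparse : suc d' * count (outside A) (suc n) < suc n
  sparse = complement-sparse d' A ¬bound
  0∉A : outside A 0 ≡ true
  0∉A = cubeFree⇒0∉ (suc n) d' A cubeFree
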